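{- For no integer $d\neq 3$ does a $(3,3,d)$-endblock $B(3,2)$ exist.
   Context: All graphs are finite and simple, considered with a fixed plane embedding; the degree of a face is the length of its boundary. A $(k,d_1,d)$-endblock $B(k,l)$ is a $2$-connected plane graph on $n$ vertices such that $n-1$ vertices have degree $k$, one exceptional vertex $x_1$ has degree $l$ with $1<l<k$, all faces but one have common degree $d_1$, the remaining face has degree $d\neq d_1$, and $x_1$ lies on the boundary of the face of degree $d$. -}

module Defs where

open import Data.Nat using (ℕ; zero; suc; _+_; _*_; _<_)
open import Data.Fin using (Fin; _≟_)
open import Data.List using (List; length; filter; allFin)
open import Data.Product using (Σ; ∃; ∃-syntax; _×_; _,_)
open import Function using (_∘_)
open import Relation.Binary.PropositionalEquality using (_≡_; _≢_)
open import Relation.Nullary using (¬_)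

iter : ∀ {A : Set} → (A → A) → ℕ → A → A
iter f zero    x = x
iter f (suc k) x = f (iter f k x)

countFib : ∀ {D N} → (Fin D → Fin N) → Fin N → ℕ
countFib {D} g x = length (filter (λ d → g d ≟ x) (allFin D))

-- A connected plane graph with a fixed embedding, given as a
-- combinatorial map (rotation system) of genus 0.
--
-- * vertices : Fin n, darts (half-edges) : Fin D, faces : Fin f
-- * α : fixed-point-free involution on darts (the two halves of an edge)
-- * σ : permutation of darts; its orbits are the vertices, i.e. σ
--       preserves `tail` and acts transitively on each fibre of `tail`
--       (σ gives the cyclic order of darts around each vertex)
-- * the faces are the orbits of φ = σ ∘ α: `face` is φ-invariant,
--   φ acts transitively on each fibre of `face`, and `face` is onto.
-- * Euler's formula n - m + f = 2 with m = D/2 edges, written as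
--   2n + 2f = D + 4 (genus 0, i.e. the embedding is planar).
-- * simplicity: no loops, no multiple edges.
-- The degree of a face is the length of its boundary walk = size of its
-- φ-orbit; the degree of a vertex is the number of darts at it.
record PlaneGraph (n : ℕ) : Set where
  field
    D f    : ℕ
    tail   : Fin D → Fin n
    α σ    : Fin D → Fin D
    face   : Fin D → Fin f
    α-invol    : ∀ d → α (α d) ≡ d
    α-nofix    : ∀ d → α d ≢ d
    σ-inj      : ∀ d d' → σ d ≡ σ d' → d ≡ d'
    σ-tail     : ∀ d → tail (σ d) ≡ tail d
    σ-trans    : ∀ d d' → tail d ≡ tail d' → ∃[ k ] iter σ k d ≡ d'
    tail-onto  : ∀ v → ∃[ d ] tail d ≡ v
    φ-face     : ∀ d → face (σ (α d)) ≡ face d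
    φ-trans    : ∀ d d' → face d ≡ face d' → ∃[ k ] iter (σ ∘ α) k d ≡ d'
    face-onto  : ∀ F → ∃[ d ] face d ≡ F
    euler      : 2 * n + 2 * f ≡ D + 4
    no-loop    : ∀ d → tail (α d) ≢ tail d
    no-multi   : ∀ d d' → tail d ≡ tail d' → tail (α d) ≡ tail (α d') → d ≡ d'

  Adj : Fin n → Fin n → Set
  Adj u v = ∃[ d ] (tail d ≡ u × tail (α d) ≡ v)

  vdeg : Fin n → ℕ
  vdeg = countFib tail

  fdeg : Fin f → ℕ
  fdeg = countFib face

  OnFace : Fin n → Fin f → Set
  OnFace v F = ∃[ d ] (tail d ≡ v × face d ≡ F)

data ReachAvoid {n} (G : PlaneGraph n) (w : Fin n) : Fin n → Fin n → Set where
  here : ∀ {u} → ReachAvoid G w u u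
  step : ∀ {u v x} → PlaneGraph.Adj G u x → x ≢ w →
         ReachAvoid G w x v → ReachAvoid G w u v

data Reach {n} (G : PlaneGraph n) : Fin n → Fin n → Set where
  here : ∀ {u} → Reach G u u
  step : ∀ {u v x} → PlaneGraph.Adj G u x → Reach G x v → Reach G u v

TwoConnected : ∀ {n} → PlaneGraph n → Set
TwoConnected {n} G =
  (2 < n) × (∀ u v → Reach G u v) ×
  (∀ w u v → u ≢ w → v ≢ w → ReachAvoid G w u v)

record Endblock (k l d₁ d : ℕ) : Set where
  field
    n      : ℕ
    G      : PlaneGraph n
    2conn  : TwoConnected G
    x₁     : Fin n
    F₀     : Fin (PlaneGraph.f G)
    1<l    : 1 < l
    l<k    : l < k
    d≢d₁   : d ≢ d₁
    deg-x₁ : PlaneGraph.vdeg G x₁ ≡ l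
    deg-v  : ∀ v → v ≢ x₁ → PlaneGraph.vdeg G v ≡ k
    deg-F₀ : PlaneGraph.fdeg G F₀ ≡ d
    deg-F  : ∀ F → F ≢ F₀ → PlaneGraph.fdeg G F ≡ d₁
    x₁∈F₀  : PlaneGraph.OnFace G x₁ F₀

-- Call a dart triangular if it does not lie on F₀; all other faces are triangles.
-- Counting darts by vertex degrees and by face degrees and using Euler's formula
-- shows that there are exactly d + 4 triangular darts.  On the other hand no vertex
-- has all its corners in triangles: at x₁ this would create a double edge, and at a
-- cubic vertex the three triangles would span a K₄ forming a whole component without
-- x₁.  This yields an injection of the triangular darts into the d darts of F₀,
-- except for those whose triangle has x₁ as opposite vertex, and φ² maps these
-- injectively to the two darts at x₁.  Hence there are at most d + 2 triangular darts.
module Submission where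

open import Defs
open import Data.Empty using (⊥)
open import Data.Fin using (Fin; _≟_)
open import Data.List using (List; []; _∷_; length; filter; allFin; map)
open import Data.List.Membership.Propositional using (_∈_; _∉_)
open import Data.List.Membership.Propositional.Properties
  using (∈-filter⁺; ∈-filter⁻; ∈-allFin; ∈-map⁺; ∈-map⁻)
open import Data.List.Properties using (filter-notAll; length-map; length-tabulate; map-cong)
open import Data.List.Relation.Binary.Subset.Propositional using (_⊆_)
open import Data.List.Relation.Unary.All as All using (All; []; _∷_)
open import Data.List.Relation.Unary.AllPairs using ([]; _∷_)
open import Data.List.Relation.Unary.Any as Any using (here; there)
open import Data.List.Relation.Unary.Unique.Propositional using (Unique)
open import Data.List.Relation.Unary.Unique.Propositional.Properties using (filter⁺; allFin⁺)
open import Data.Nat using (ℕ; zero; suc; _+_; _*_; _≤_; s≤s; z≤n)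
open import Data.Nat.ListAction using (sum)
open import Data.Nat.Properties
  using (≤-trans; ≤-reflexive; +-suc; +-mono-≤; m≤n⇒m≤1+n; ≤-antisym; +-cancelˡ-≡; +-cancelʳ-≡; +-cancelˡ-≤; +-assoc; *-identityˡ; <⇒≱; <⇒≤; module ≤-Reasoning)
open import Data.Nat.Tactic.RingSolver using (solve-∀)
open import Data.Product using (∃-syntax; _×_; _,_; proj₁; proj₂)
open import Data.Sum using (_⊎_; inj₁; inj₂)
open import Function using (_∘_; id)
open import Relation.Binary.PropositionalEquality
  using (_≡_; _≢_; refl; sym; trans; cong; cong₂; subst; module ≡-Reasoning)
open import Relation.Nullary using (¬_; yes; no; ¬?; contradiction)
open import Relation.Nullary.Decidable using (decidable-stable)
open import Level using (0ℓ)
open import Relation.Unary using (Pred; Decidable)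
open import Relation.Unary.Properties using (∁?; _∩?_)

Unique-⊆⇒length≤ : ∀ {m} {xs ys : List (Fin m)} → Unique xs → xs ⊆ ys → length xs ≤ length ys
Unique-⊆⇒length≤ {xs = []} _ _ = z≤n
Unique-⊆⇒length≤ {xs = x ∷ xs} {ys} (x∉xs ∷ xs!) x∷xs⊆ys =
  ≤-trans (s≤s (Unique-⊆⇒length≤ xs! xs⊆ys-x))
          (filter-notAll x≢? ys (Any.map (λ x≡ x≢ → x≢ x≡) (x∷xs⊆ys (here refl))))
  where
  x≢? : Decidable (x ≢_)
  x≢? z = ¬? (x ≟ z)
  xs⊆ys-x : xs ⊆ filter x≢? ys
  xs⊆ys-x z∈xs = ∈-filter⁺ x≢? (x∷xs⊆ys (there z∈xs)) (All.lookup x∉xs z∈xs)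

Unique-map-injectiveOn : ∀ {m m'} {P : Pred (Fin m) 0ℓ} (ψ : Fin m → Fin m') →
                         (∀ {x y} → P x → P y → ψ x ≡ ψ y → x ≡ y) →
                         ∀ {xs} → All P xs → Unique xs → Unique (map ψ xs)
Unique-map-injectiveOn ψ ψ-inj [] [] = []
Unique-map-injectiveOn {P = P} ψ ψ-inj {x ∷ xs} (px ∷ pxs) (x∉xs ∷ xs!) =
  ψx∉ pxs x∉xs ∷ Unique-map-injectiveOn ψ ψ-inj pxs xs!
  where
  ψx∉ : ∀ {ys} → All P ys → All (x ≢_) ys → All (ψ x ≢_) (map ψ ys)
  ψx∉ [] [] = []
  ψx∉ (py ∷ pys) (x≢y ∷ x≢ys) = (λ ψx≡ψy → x≢y (ψ-inj px py ψx≡ψy)) ∷ ψx∉ pys x≢ys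

module _ {m m' : ℕ} {P : Pred (Fin m) 0ℓ} {Q : Pred (Fin m') 0ℓ} (P? : Decidable P) (Q? : Decidable Q) where

  length-filter-allFin-injection : (ψ : Fin m → Fin m') → (∀ {x} → P x → Q (ψ x)) →
    (∀ {x y} → P x → P y → ψ x ≡ ψ y → x ≡ y) →
    length (filter P? (allFin m)) ≤ length (filter Q? (allFin m'))
  length-filter-allFin-injection ψ P⇒Qψ ψ-inj = begin
    length Ps            ≡⟨ length-map ψ Ps ⟨
    length (map ψ Ps)    ≤⟨ Unique-⊆⇒length≤ (Unique-map-injectiveOn ψ ψ-inj All-P (filter⁺ P? {allFin m} (allFin⁺ m))) ψPs⊆Qs ⟩
    length (filter Q? (allFin m')) ∎
    where
    open ≤-Reasoning
    Ps : List (Fin m)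
    Ps = filter P? (allFin m)
    All-P : All P Ps
    All-P = All.tabulate (λ x∈ → proj₂ (∈-filter⁻ P? {xs = allFin m} x∈))
    ψPs⊆Qs : map ψ Ps ⊆ filter Q? (allFin m')
    ψPs⊆Qs z∈ with ∈-map⁻ ψ z∈
    ... | x , x∈ , refl = ∈-filter⁺ Q? (∈-allFin (ψ x)) (P⇒Qψ (proj₂ (∈-filter⁻ P? {xs = allFin m} x∈)))

module _ {A : Set} {P : Pred A 0ℓ} (P? : Decidable P) where

  length-filter+length-filter-∁ : ∀ xs → length (filter P? xs) + length (filter (∁? P?) xs) ≡ length xs
  length-filter+length-filter-∁ [] = refl
  length-filter+length-filter-∁ (x ∷ xs) with P? x
  ... | yes _ = cong suc (length-filter+length-filter-∁ xs)
  ... | no  _ = trans (+-suc _ _) (cong suc (length-filter+length-filter-∁ xs))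

  length-filter≤length-filter-∩∁+ : ∀ {Q : Pred A 0ℓ} (Q? : Decidable Q) xs →
    length (filter P? xs) ≤ length (filter (P? ∩? ∁? Q?) xs) + length (filter Q? xs)
  length-filter≤length-filter-∩∁+ Q? [] = z≤n
  length-filter≤length-filter-∩∁+ Q? (x ∷ xs) with P? x | Q? x
  ... | yes _ | yes _ = ≤-trans (s≤s (length-filter≤length-filter-∩∁+ Q? xs)) (≤-reflexive (sym (+-suc _ _)))
  ... | yes _ | no  _ = s≤s (length-filter≤length-filter-∩∁+ Q? xs)
  ... | no  _ | yes _ = ≤-trans (m≤n⇒m≤1+n (length-filter≤length-filter-∩∁+ Q? xs)) (≤-reflexive (sym (+-suc _ _)))
  ... | no  _ | no  _ = length-filter≤length-filter-∩∁+ Q? xs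

length-filter-≟-allFin : ∀ {N} (y : Fin N) → length (filter (y ≟_) (allFin N)) ≡ 1
length-filter-≟-allFin {N} y = ≤-antisym
  (Unique-⊆⇒length≤ {ys = y ∷ []} (filter⁺ (y ≟_) {allFin N} (allFin⁺ N))
    (λ z∈ → here (sym (proj₂ (∈-filter⁻ (y ≟_) {xs = allFin N} z∈)))))
  (Unique-⊆⇒length≤ {xs = y ∷ []} ([] ∷ []) (λ { (here refl) → ∈-filter⁺ (y ≟_) (∈-allFin y) refl }))

sum-map-+ : ∀ {A : Set} (a b : A → ℕ) (xs : List A) →
            sum (map (λ x → a x + b x) xs) ≡ sum (map a xs) + sum (map b xs)
sum-map-+ a b [] = refl
sum-map-+ a b (x ∷ xs) rewrite sum-map-+ a b xs = swap (a x) (b x) (sum (map a xs)) (sum (map b xs))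
  where
  swap : ∀ p q r s → p + q + (r + s) ≡ p + r + (q + s)
  swap = solve-∀

module _ {D N : ℕ} (g : Fin D → Fin N) where

  #fibre : List (Fin D) → Fin N → ℕ
  #fibre es v = length (filter (λ e → g e ≟ v) es)

  #fibre-∷ : ∀ e es v → #fibre (e ∷ es) v ≡ #fibre (e ∷ []) v + #fibre es v
  #fibre-∷ e es v with g e ≟ v
  ... | yes _ = refl
  ... | no  _ = refl

  sum-#fibre-singleton : ∀ e (vs : List (Fin N)) → sum (map (#fibre (e ∷ [])) vs) ≡ length (filter (g e ≟_) vs)
  sum-#fibre-singleton e [] = refl
  sum-#fibre-singleton e (v ∷ vs) with g e ≟ v
  ... | yes _ = cong suc (sum-#fibre-singleton e vs)
  ... | no  _ = sum-#fibre-singleton e vs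

  sum-#fibre : ∀ es → sum (map (#fibre es) (allFin N)) ≡ length es
  sum-#fibre [] = sum-zeros (allFin N)
    where
    sum-zeros : ∀ (vs : List (Fin N)) → sum (map (λ _ → 0) vs) ≡ 0
    sum-zeros [] = refl
    sum-zeros (_ ∷ vs) = sum-zeros vs
  sum-#fibre (e ∷ es) = begin
    sum (map (#fibre (e ∷ es)) (allFin N))
      ≡⟨ cong sum (map-cong (#fibre-∷ e es) (allFin N)) ⟩
    sum (map (λ v → #fibre (e ∷ []) v + #fibre es v) (allFin N))
      ≡⟨ sum-map-+ (#fibre (e ∷ [])) (#fibre es) (allFin N) ⟩
    sum (map (#fibre (e ∷ [])) (allFin N)) + sum (map (#fibre es) (allFin N))
      ≡⟨ cong₂ _+_ (trans (sum-#fibre-singleton e (allFin N)) (length-filter-≟-allFin (g e))) (sum-#fibre es) ⟩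
    suc (length es) ∎
    where open ≡-Reasoning

module _ {N c : ℕ} (h : Fin N → ℕ) (y : Fin N) (h≡c : ∀ v → v ≢ y → h v ≡ c) where

  private
    sum-almost-constant-list : ∀ (vs : List (Fin N)) → let k = length (filter (y ≟_) vs) in
      sum (map h vs) + k * c ≡ length vs * c + k * h y
    sum-almost-constant-list [] = refl
    sum-almost-constant-list (v ∷ vs) with y ≟ v | sum-almost-constant-list vs
    ... | yes refl | ih = begin
      h y + sum (map h vs) + suc k * c       ≡⟨ split (h y) (sum (map h vs)) k c ⟩
      h y + c + (sum (map h vs) + k * c)     ≡⟨ cong (h y + c +_) ih ⟩
      h y + c + (length vs * c + k * h y)    ≡⟨ merge (h y) (length vs) k c ⟩
      suc (length vs) * c + suc k * h y      ∎
      where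
      open ≡-Reasoning
      k : ℕ
      k = length (filter (y ≟_) vs)
      split : ∀ a s k c → a + s + suc k * c ≡ a + c + (s + k * c)
      split = solve-∀
      merge : ∀ a l k c → a + c + (l * c + k * a) ≡ suc l * c + suc k * a
      merge = solve-∀
    ... | no y≢v | ih = begin
      h v + sum (map h vs) + k * c           ≡⟨ cong (λ x → x + sum (map h vs) + k * c) (h≡c v (y≢v ∘ sym)) ⟩
      c + sum (map h vs) + k * c             ≡⟨ +-assoc c _ _ ⟩
      c + (sum (map h vs) + k * c)           ≡⟨ cong (c +_) ih ⟩
      c + (length vs * c + k * h y)          ≡⟨ +-assoc c _ _ ⟨
      suc (length vs) * c + k * h y          ∎
      where
      open ≡-Reasoning
      k : ℕ
      k = length (filter (y ≟_) vs)

  sum-almost-constant : sum (map h (allFin N)) + c ≡ N * c + h y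
  sum-almost-constant = begin
    sum (map h (allFin N)) + c                    ≡⟨ cong (sum (map h (allFin N)) +_) (*-identityˡ c) ⟨
    sum (map h (allFin N)) + 1 * c                ≡⟨ cong (λ k → sum (map h (allFin N)) + k * c) (length-filter-≟-allFin y) ⟨
    sum (map h (allFin N)) + k * c                ≡⟨ sum-almost-constant-list (allFin N) ⟩
    length (allFin N) * c + k * h y               ≡⟨ cong₂ (λ l k → l * c + k * h y) (length-tabulate {n = N} id) (length-filter-≟-allFin y) ⟩
    N * c + 1 * h y                               ≡⟨ cong (N * c +_) (*-identityˡ (h y)) ⟩
    N * c + h y                                   ∎
    where
    open ≡-Reasoning
    k : ℕ
    k = length (filter (y ≟_) (allFin N))

fibres-almost-constant : ∀ {D N c} (g : Fin D → Fin N) (y : Fin N) → (∀ v → v ≢ y → countFib g v ≡ c) →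
                         D + c ≡ N * c + countFib g y
fibres-almost-constant {D} {N} {c} g y fibre≡c = begin
  D + c                                    ≡⟨ cong (_+ c) (trans (sum-#fibre g (allFin D)) (length-tabulate {n = D} id)) ⟨
  sum (map (countFib g) (allFin N)) + c    ≡⟨ sum-almost-constant (countFib g) y fibre≡c ⟩
  N * c + countFib g y                     ∎
  where open ≡-Reasoning

iter-preserves : ∀ {A : Set} (P : A → Set) {f : A → A} → (∀ {z} → P z → P (f z)) →
                 ∀ {x} → P x → ∀ k → P (iter f k x)
iter-preserves P f-pres Px zero    = Px
iter-preserves P f-pres Px (suc k) = f-pres (iter-preserves P f-pres Px k)

module Orbit {D N : ℕ} (p : Fin D → Fin D) (g : Fin D → Fin N)
  (p-injective : ∀ a b → p a ≡ p b → a ≡ b)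
  (g∘p≗g : ∀ a → g (p a) ≡ g a)
  (p-transitive : ∀ a b → g a ≡ g b → ∃[ k ] iter p k a ≡ b) where

  g∘iter≗g : ∀ k x → g (iter p k x) ≡ g x
  g∘iter≗g zero    x = refl
  g∘iter≗g (suc k) x = trans (g∘p≗g (iter p k x)) (g∘iter≗g k x)

  fibre⊆orbit : ∀ {x xs} → (∀ k → iter p k x ∈ xs) → ∀ {z} → g z ≡ g x → z ∈ xs
  fibre⊆orbit {x} {xs} orbit⊆xs {z} gz≡gx with p-transitive x z (sym gz≡gx)
  ... | k , pᵏx≡z = subst (_∈ xs) pᵏx≡z (orbit⊆xs k)

  fibre-size≤ : ∀ {x xs} → (∀ k → iter p k x ∈ xs) → countFib g (g x) ≤ length xs
  fibre-size≤ {x} orbit⊆xs = Unique-⊆⇒length≤ (filter⁺ (λ d → g d ≟ g x) {allFin D} (allFin⁺ D))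
    (λ z∈ → fibre⊆orbit orbit⊆xs (proj₂ (∈-filter⁻ (λ d → g d ≟ g x) {xs = allFin D} z∈)))

  fibre-size≥ : ∀ {x xs} → Unique xs → All (λ z → g z ≡ g x) xs → length xs ≤ countFib g (g x)
  fibre-size≥ {x} xs! in-fibre = Unique-⊆⇒length≤ xs! (λ z∈ → ∈-filter⁺ (λ d → g d ≟ g x) (∈-allFin _) (All.lookup in-fibre z∈))

  orbit₁ : ∀ {x} → p x ≡ x → ∀ k → iter p k x ∈ x ∷ []
  orbit₁ px≡x = iter-preserves (_∈ _ ∷ []) (λ { (here refl) → here px≡x }) (here refl)

  orbit₂ : ∀ {x} → p (p x) ≡ x → ∀ k → iter p k x ∈ x ∷ p x ∷ []
  orbit₂ p²x≡x = iter-preserves (_∈ _ ∷ _ ∷ [])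
    (λ { (here refl) → there (here refl) ; (there (here refl)) → here p²x≡x }) (here refl)

  orbit₃ : ∀ {x} → p (p (p x)) ≡ x → ∀ k → iter p k x ∈ x ∷ p x ∷ p (p x) ∷ []
  orbit₃ p³x≡x = iter-preserves (_∈ _ ∷ _ ∷ _ ∷ [])
    (λ { (here refl) → there (here refl)
       ; (there (here refl)) → there (there (here refl))
       ; (there (there (here refl))) → here p³x≡x })
    (here refl)

  module _ {x : Fin D} where

    p≢id : 2 ≤ countFib g (g x) → p x ≢ x
    p≢id 2≤size px≡x = <⇒≱ 2≤size (fibre-size≤ (orbit₁ px≡x))

    p²≢id : 3 ≤ countFib g (g x) → p (p x) ≢ x
    p²≢id 3≤size p²x≡x = <⇒≱ 3≤size (fibre-size≤ (orbit₂ p²x≡x))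

    fibre≡2⇒p²≡id : countFib g (g x) ≡ 2 → p (p x) ≡ x
    fibre≡2⇒p²≡id size≡2 = decidable-stable (p (p x) ≟ x) λ p²x≢x →
      <⇒≱ (≤-reflexive (cong suc size≡2))
          (fibre-size≥ (distinct p²x≢x) (refl ∷ g∘iter≗g 1 x ∷ g∘iter≗g 2 x ∷ []))
      where
      px≢x : p x ≢ x
      px≢x = p≢id (≤-reflexive (sym size≡2))
      distinct : p (p x) ≢ x → Unique (x ∷ p x ∷ p (p x) ∷ [])
      distinct p²x≢x = (px≢x ∘ sym ∷ p²x≢x ∘ sym ∷ [])
                     ∷ ((λ e → px≢x (sym (p-injective _ _ e))) ∷ [])
                     ∷ [] ∷ []

    fibre≡3⇒p³≡id : countFib g (g x) ≡ 3 → p (p (p x)) ≡ x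
    fibre≡3⇒p³≡id size≡3 = decidable-stable (p (p (p x)) ≟ x) λ p³x≢x →
      <⇒≱ (≤-reflexive (cong suc size≡3))
          (fibre-size≥ (distinct p³x≢x) (refl ∷ g∘iter≗g 1 x ∷ g∘iter≗g 2 x ∷ g∘iter≗g 3 x ∷ []))
      where
      3≤size : 3 ≤ countFib g (g x)
      3≤size = ≤-reflexive (sym size≡3)
      px≢x : p x ≢ x
      px≢x = p≢id (<⇒≤ 3≤size)
      p²x≢x : p (p x) ≢ x
      p²x≢x = p²≢id 3≤size
      distinct : p (p (p x)) ≢ x → Unique (x ∷ p x ∷ p (p x) ∷ p (p (p x)) ∷ [])
      distinct p³x≢x = (px≢x ∘ sym ∷ p²x≢x ∘ sym ∷ p³x≢x ∘ sym ∷ [])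
                     ∷ ((λ e → px≢x (sym (p-injective _ _ e))) ∷ (λ e → p²x≢x (sym (p-injective _ _ e))) ∷ [])
                     ∷ ((λ e → px≢x (sym (p-injective _ _ (p-injective _ _ e)))) ∷ [])
                     ∷ [] ∷ []

darts≡2d+4 : ∀ {D n f d} → D + 3 ≡ n * 3 + 2 → D + 3 ≡ f * 3 + d → 2 * n + 2 * f ≡ D + 4 → D ≡ 2 * d + 4
darts≡2d+4 {D} {n} {f} {d} vertex-count face-count euler = +-cancelʳ-≡ (3 * D + 12) D (2 * d + 4) (begin
  D + (3 * D + 12)                     ≡⟨ double D ⟩
  2 * (D + 3) + 2 * (D + 3)            ≡⟨ cong₂ (λ x y → 2 * x + 2 * y) vertex-count face-count ⟩
  2 * (n * 3 + 2) + 2 * (f * 3 + d)    ≡⟨ regroup n f d ⟩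
  3 * (2 * n + 2 * f) + (2 * d + 4)    ≡⟨ cong (λ x → 3 * x + (2 * d + 4)) euler ⟩
  3 * (D + 4) + (2 * d + 4)            ≡⟨ expand D d ⟩
  2 * d + 4 + (3 * D + 12)             ∎)
  where
  open ≡-Reasoning
  double : ∀ D → D + (3 * D + 12) ≡ 2 * (D + 3) + 2 * (D + 3)
  double = solve-∀
  regroup : ∀ n f d → 2 * (n * 3 + 2) + 2 * (f * 3 + d) ≡ 3 * (2 * n + 2 * f) + (2 * d + 4)
  regroup = solve-∀
  expand : ∀ D d → 3 * (D + 4) + (2 * d + 4) ≡ 2 * d + 4 + (3 * D + 12)
  expand = solve-∀

Reach-preserves : ∀ {n} {G : PlaneGraph n} (C : Fin n → Set) →
                  (∀ {u w} → PlaneGraph.Adj G u w → C u → C w) → ∀ {u v} → Reach G u v → C u → C v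
Reach-preserves C adj-pres here         Cu = Cu
Reach-preserves C adj-pres (step adj r) Cu = Reach-preserves C adj-pres r (adj-pres adj Cu)

module CubicEndblock {d : ℕ} (B : Endblock 3 2 3 d) where

  open Endblock B
  open PlaneGraph G

  φ : Fin D → Fin D
  φ = σ ∘ α

  α-injective : ∀ a b → α a ≡ α b → a ≡ b
  α-injective a b αa≡αb = trans (sym (α-invol a)) (trans (cong α αa≡αb) (α-invol b))

  φ-injective : ∀ a b → φ a ≡ φ b → a ≡ b
  φ-injective a b φa≡φb = α-injective a b (σ-inj _ _ φa≡φb)

  face∘σ≗face∘α : ∀ e → face (σ e) ≡ face (α e)
  face∘σ≗face∘α e = subst (λ z → face (σ z) ≡ face (α e)) (α-invol e) (φ-face (α e))

  private
    module Vertex = Orbit σ tail σ-inj σ-tail σ-trans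
    module Face = Orbit φ face φ-injective φ-face φ-trans

  σ³≡id : ∀ {e} → tail e ≢ x₁ → σ (σ (σ e)) ≡ e
  σ³≡id e-cubic = Vertex.fibre≡3⇒p³≡id (deg-v _ e-cubic)

  σ²≢id : ∀ {e} → tail e ≢ x₁ → σ (σ e) ≢ e
  σ²≢id e-cubic = Vertex.p²≢id (≤-reflexive (sym (deg-v _ e-cubic)))

  σ²≡id-at-x₁ : ∀ {e} → tail e ≡ x₁ → σ (σ e) ≡ e
  σ²≡id-at-x₁ e-at-x₁ = Vertex.fibre≡2⇒p²≡id (trans (cong vdeg e-at-x₁) deg-x₁)

  darts-at-cubic : ∀ {e d} → tail e ≢ x₁ → tail d ≡ tail e → d ∈ e ∷ σ e ∷ σ (σ e) ∷ []
  darts-at-cubic e-cubic = Vertex.fibre⊆orbit (Vertex.orbit₃ (σ³≡id e-cubic))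

  Triangular : Fin D → Set
  Triangular e = face e ≢ F₀

  φ³≡id : ∀ {e} → Triangular e → φ (φ (φ e)) ≡ e
  φ³≡id {e} e-tri = Face.fibre≡3⇒p³≡id (deg-F (face e) e-tri)

  φ²≡α∘σ⁻¹ : ∀ {e q} → Triangular e → σ q ≡ e → φ (φ e) ≡ α q
  φ²≡α∘σ⁻¹ {e} e-tri σq≡e = trans (sym (α-invol _)) (cong α (σ-inj _ _ (trans (φ³≡id e-tri) (sym σq≡e))))

  Triangular-σ : ∀ {e} → Triangular (α e) → Triangular (σ e)
  Triangular-σ {e} αe-tri = αe-tri ∘ trans (sym (face∘σ≗face∘α e))

  -- Both triangles at x₁ contain an edge joining its two neighbours; by simplicity
  -- these edges coincide, and then that neighbour has degree 2.
  x₁-not-between-triangles : ∀ {e} → tail e ≡ x₁ → Triangular e → Triangular (σ e) → ⊥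
  x₁-not-between-triangles {e} e-at-x₁ e-tri σe-tri = σ²≢id y-cubic (trans (cong σ σy≡αe) φe≡y)
    where
    y : Fin D
    y = α (φ (σ e))
    σy≡αe : σ y ≡ α e
    σy≡αe = φ²≡α∘σ⁻¹ σe-tri refl
    tail-y : tail y ≡ tail (α e)
    tail-y = trans (sym (σ-tail y)) (cong tail σy≡αe)
    y-cubic : tail y ≢ x₁
    y-cubic y-at-x₁ = no-loop e (trans (trans (sym tail-y) y-at-x₁) (sym e-at-x₁))
    φe≡y : φ e ≡ y
    φe≡y = no-multi (φ e) y (trans (σ-tail (α e)) (sym tail-y)) (begin
      tail (α (φ e))        ≡⟨ σ-tail (α (φ e)) ⟨
      tail (φ (φ e))        ≡⟨ cong tail (φ²≡α∘σ⁻¹ e-tri (σ²≡id-at-x₁ e-at-x₁)) ⟩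
      tail (α (σ e))        ≡⟨ σ-tail (α (σ e)) ⟨
      tail (φ (σ e))        ≡⟨ cong tail (α-invol (φ (σ e))) ⟨
      tail (α y)            ∎)
      where open ≡-Reasoning

  head≢x₁ : ∀ {e} → Triangular e → Triangular (σ e) → tail (α e) ≢ x₁
  head≢x₁ {e} e-tri σe-tri αe-at-x₁ =
    x₁-not-between-triangles αe-at-x₁ (σe-tri ∘ trans (face∘σ≗face∘α e)) (e-tri ∘ trans (sym (φ-face e)))

  Surrounded : Fin D → Set
  Surrounded e = tail e ≢ x₁ × Triangular e × Triangular (σ e) × Triangular (σ (σ e))

  surrounded-σ : ∀ {e} → Surrounded e → Surrounded (σ e)
  surrounded-σ {e} (e-cubic , t₀ , t₁ , t₂) =
    e-cubic ∘ trans (sym (σ-tail e)) , t₁ , t₂ , t₀ ∘ trans (cong face (sym (σ³≡id e-cubic)))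

  star : Fin D → List (Fin n)
  star e = tail e ∷ map (tail ∘ α) (e ∷ σ e ∷ σ (σ e) ∷ [])

  star-σ⊆star : ∀ {e} → Surrounded e → star (σ e) ⊆ star e
  star-σ⊆star {e} (e-cubic , _) = λ
    { (here refl) → here (σ-tail e)
    ; (there (here refl)) → there (there (here refl))
    ; (there (there (here refl))) → there (there (there (here refl)))
    ; (there (there (there (here refl)))) → there (here (cong (tail ∘ α) (σ³≡id e-cubic)))
    }

  tail-neighbour∈star : ∀ {e d} → Surrounded e → tail d ≡ tail e → tail (α d) ∈ star e
  tail-neighbour∈star (e-cubic , _) td≡te = there (∈-map⁺ (tail ∘ α) (darts-at-cubic e-cubic td≡te))

  head-neighbour∈star : ∀ {e d} → Surrounded e → tail d ≡ tail (α e) → tail (α d) ∈ star e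
  head-neighbour∈star {e} (e-cubic , t₀ , t₁ , _) td≡tαe with darts-at-cubic (head≢x₁ t₀ t₁) td≡tαe
  ... | here refl = here (cong tail (α-invol e))
  ... | there (here refl) = there (there (there (here (begin
    tail (α (φ e))         ≡⟨ σ-tail (α (φ e)) ⟨
    tail (φ (φ e))         ≡⟨ cong tail (φ²≡α∘σ⁻¹ t₀ (σ³≡id e-cubic)) ⟩
    tail (α (σ (σ e)))     ∎))))
    where open ≡-Reasoning
  ... | there (there (here refl)) = there (there (here (begin
    tail (α (σ (σ (α e)))) ≡⟨ cong (tail ∘ α) σσαe≡y ⟩
    tail (α y)             ≡⟨ cong tail (α-invol (φ (σ e))) ⟩
    tail (φ (σ e))         ≡⟨ σ-tail (α (σ e)) ⟩
    tail (α (σ e))         ∎)))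
    where
    open ≡-Reasoning
    y : Fin D
    y = α (φ (σ e))
    σy≡αe : σ y ≡ α e
    σy≡αe = φ²≡α∘σ⁻¹ t₁ refl
    y-cubic : tail y ≢ x₁
    y-cubic = head≢x₁ t₀ t₁ ∘ trans (trans (sym (cong tail σy≡αe)) (σ-tail y))
    σσαe≡y : σ (σ (α e)) ≡ y
    σσαe≡y = trans (cong (σ ∘ σ) (sym σy≡αe)) (σ³≡id y-cubic)

  star-closed : ∀ {e u w} → Surrounded e → Adj u w → u ∈ star e → w ∈ star e
  star-closed s (d , refl , refl) (here td≡te) = tail-neighbour∈star s td≡te
  star-closed s (d , refl , refl) (there (here td≡b₀)) = head-neighbour∈star s td≡b₀
  star-closed s (d , refl , refl) (there (there (here td≡b₁))) =
    star-σ⊆star s (head-neighbour∈star (surrounded-σ s) td≡b₁)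
  star-closed s (d , refl , refl) (there (there (there (here td≡b₂)))) =
    star-σ⊆star s (star-σ⊆star (surrounded-σ s) (head-neighbour∈star (surrounded-σ (surrounded-σ s)) td≡b₂))

  x₁∉star : ∀ {e} → Surrounded e → x₁ ∉ star e
  x₁∉star {e} (e-cubic , t₀ , t₁ , t₂) = λ
    { (here x₁≡a) → e-cubic (sym x₁≡a)
    ; (there (here x₁≡b₀)) → head≢x₁ t₀ t₁ (sym x₁≡b₀)
    ; (there (there (here x₁≡b₁))) → head≢x₁ t₁ t₂ (sym x₁≡b₁)
    ; (there (there (there (here x₁≡b₂)))) → head≢x₁ t₂ (t₀ ∘ trans (cong face (sym (σ³≡id e-cubic)))) (sym x₁≡b₂)
    }

  ¬surrounded : ∀ {e} → ¬ Surrounded e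
  ¬surrounded {e} s =
    x₁∉star s (Reach-preserves (_∈ star e) (star-closed s) (connected (tail e) x₁) (here refl))
    where
    connected : ∀ u v → Reach G u v
    connected = proj₁ (proj₂ 2conn)

  corners-not-all-triangular : ∀ {e} → Triangular e → Triangular (σ e) →
                               (tail e ≢ x₁ → Triangular (σ (σ e))) → ⊥
  corners-not-all-triangular {e} t₀ t₁ t₂ with tail e ≟ x₁
  ... | yes e-at-x₁ = x₁-not-between-triangles e-at-x₁ t₀ t₁
  ... | no  e-cubic = ¬surrounded (e-cubic , t₀ , t₁ , t₂ e-cubic)

  σφ²-in-F₀ : ∀ {e} → Triangular e → Triangular (α e) → face (σ (φ (φ e))) ≡ F₀
  σφ²-in-F₀ {e} t₀ αe-tri = decidable-stable (face (σ (φ (φ e))) ≟ F₀) λ σφ²e-tri →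
    corners-not-all-triangular t₀ (Triangular-σ αe-tri) λ e-cubic →
      σφ²e-tri ∘ trans (face∘σ≗face∘α (φ (φ e))) ∘ trans (cong face (sym (σσe≡αφ²e e-cubic)))
    where
    σσe≡αφ²e : tail e ≢ x₁ → σ (σ e) ≡ α (φ (φ e))
    σσe≡αφ²e e-cubic = σ-inj _ _ (trans (σ³≡id e-cubic) (sym (φ³≡id t₀)))

  OppositeIsX₁ : Fin D → Set
  OppositeIsX₁ e = tail (φ (φ e)) ≡ x₁

  α≢σφ² : ∀ {a b} → Triangular a → Triangular b → Triangular (α b) → ¬ OppositeIsX₁ b →
          α a ≢ σ (φ (φ b))
  α≢σφ² {a} {b} a-tri b-tri αb-tri opposite≢x₁ αa≡σφ²b =
    corners-not-all-triangular αb-tri (b-tri ∘ trans (sym (φ-face b))) λ _ → Triangular-σ αφb-tri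
    where
    αφb-cubic : tail (α (φ b)) ≢ x₁
    αφb-cubic = opposite≢x₁ ∘ trans (σ-tail (α (φ b)))
    σαa≡αφb : σ (α a) ≡ α (φ b)
    σαa≡αφb = trans (cong σ αa≡σφ²b) (σ³≡id αφb-cubic)
    αφb-tri : Triangular (α (φ b))
    αφb-tri = a-tri ∘ trans (sym (φ-face a)) ∘ trans (cong face σαa≡αφb)

  -- If the edge of e does not border F₀, the third corner at tail e lies on F₀ (σφ²-in-F₀)
  -- and e is sent to the dart σ (φ (φ e)) = φ (α (φ (φ e))) of F₀; sending it to
  -- α (φ (φ e)) instead could collide with the first case.
  outer : Fin D → Fin D
  outer e with face (α e) ≟ F₀
  ... | yes _ = α e
  ... | no  _ = σ (φ (φ e))

  outer-cases : ∀ e → (face (α e) ≡ F₀ × outer e ≡ α e) ⊎ (Triangular (α e) × outer e ≡ σ (φ (φ e)))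
  outer-cases e with face (α e) ≟ F₀
  ... | yes αe-in-F₀ = inj₁ (αe-in-F₀ , refl)
  ... | no  αe-tri   = inj₂ (αe-tri , refl)

  outer-in-F₀ : ∀ {e} → Triangular e → face (outer e) ≡ F₀
  outer-in-F₀ {e} e-tri with outer-cases e
  ... | inj₁ (αe-in-F₀ , outer≡) = trans (cong face outer≡) αe-in-F₀
  ... | inj₂ (αe-tri , outer≡)   = trans (cong face outer≡) (σφ²-in-F₀ e-tri αe-tri)

  outer-injective : ∀ {a b} → Triangular a × ¬ OppositeIsX₁ a → Triangular b × ¬ OppositeIsX₁ b →
                    outer a ≡ outer b → a ≡ b
  outer-injective {a} {b} (a-tri , a-opp) (b-tri , b-opp) outer-a≡outer-b with outer-cases a | outer-cases b
  ... | inj₁ (_ , ≡αa) | inj₁ (_ , ≡αb) = α-injective a b (trans (sym ≡αa) (trans outer-a≡outer-b ≡αb))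
  ... | inj₂ (_ , ≡σφ²a) | inj₂ (_ , ≡σφ²b) =
    φ-injective _ _ (φ-injective _ _ (σ-inj _ _ (trans (sym ≡σφ²a) (trans outer-a≡outer-b ≡σφ²b))))
  ... | inj₁ (_ , ≡αa) | inj₂ (αb-tri , ≡σφ²b) =
    contradiction (trans (sym ≡αa) (trans outer-a≡outer-b ≡σφ²b)) (α≢σφ² a-tri b-tri αb-tri b-opp)
  ... | inj₂ (αa-tri , ≡σφ²a) | inj₁ (_ , ≡αb) =
    contradiction (trans (sym ≡αb) (trans (sym outer-a≡outer-b) ≡σφ²a)) (α≢σφ² b-tri a-tri αa-tri a-opp)

  Triangular? : Decidable Triangular
  Triangular? = ∁? (λ e → face e ≟ F₀)

  OppositeIsX₁? : Decidable OppositeIsX₁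
  OppositeIsX₁? e = tail (φ (φ e)) ≟ x₁

  #triangular : ℕ
  #triangular = length (filter Triangular? (allFin D))

  #triangular≤d+2 : #triangular ≤ d + 2
  #triangular≤d+2 = ≤-trans (length-filter≤length-filter-∩∁+ Triangular? OppositeIsX₁? (allFin D)) (+-mono-≤
    (≤-trans (length-filter-allFin-injection (Triangular? ∩? ∁? OppositeIsX₁?) (λ e → face e ≟ F₀)
               outer (λ (e-tri , _) → outer-in-F₀ e-tri) outer-injective)
             (≤-reflexive deg-F₀))
    (≤-trans (length-filter-allFin-injection OppositeIsX₁? (λ e → tail e ≟ x₁)
               (φ ∘ φ) id (λ _ _ → φ-injective _ _ ∘ φ-injective _ _))
             (≤-reflexive deg-x₁)))

  #triangular≡d+4 : #triangular ≡ d + 4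
  #triangular≡d+4 = +-cancelˡ-≡ d _ _ (begin
    d + #triangular           ≡⟨ cong (_+ #triangular) deg-F₀ ⟨
    fdeg F₀ + #triangular     ≡⟨ length-filter+length-filter-∁ (λ e → face e ≟ F₀) (allFin D) ⟩
    length (allFin D)         ≡⟨ length-tabulate {n = D} id ⟩
    D                         ≡⟨ darts≡2d+4 {n = n} {f} {d} vertex-count face-count euler ⟩
    2 * d + 4                 ≡⟨ twice d ⟩
    d + (d + 4)               ∎)
    where
    open ≡-Reasoning
    vertex-count : D + 3 ≡ n * 3 + 2
    vertex-count = trans (fibres-almost-constant tail x₁ deg-v) (cong (n * 3 +_) deg-x₁)
    face-count : D + 3 ≡ f * 3 + d
    face-count = trans (fibres-almost-constant face F₀ deg-F) (cong (f * 3 +_) deg-F₀)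
    twice : ∀ d → 2 * d + 4 ≡ d + (d + 4)
    twice = solve-∀

lemma12 : ∀ (d : ℕ) → d ≢ 3 → ¬ Endblock 3 2 3 d
lemma12 d _ B = contradiction (+-cancelˡ-≤ d 4 2 (subst (_≤ d + 2) #triangular≡d+4 #triangular≤d+2))
                              λ { (s≤s (s≤s ())) }
  where open CubicEndblock B
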